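{- Let $n\geq 4$ and write $n=\sum_{i=0}^m 2^ib_i$ with $b_i\in\{0,1\}$ and $b_m=1$ (the binary expansion of $n$). For $1\le i\le m-1$ let $M_i=\begin{bmatrix}1 & 1-b_i\\ b_i & 1 \end{bmatrix}$. Then $$t(n)=(-1)^m\begin{bmatrix}1 & -1\end{bmatrix} M_{m-1}M_{m-2}\cdots M_1\begin{bmatrix}1\\ b_0 \end{bmatrix}.$$
   Context: The twisted Stern sequence is defined by $t(0)=0$, $t(1)=1$, and for $n\ge1$, $t(2n)=-t(n)$, $t(2n+1)=-t(n)-t(n+1)$. -}

module Defs where

open import Data.Nat using (ℕ; zero; suc; _+_; _*_; _^_; _/_; _%_)
open import Data.Integer as ℤ using (ℤ; +_; -_)
open import Data.Fin using (Fin; toℕ)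
open import Data.Product using (_×_; _,_)

-- Twisted Stern sequence, computed with fuel (fuel ≥ n suffices).
-- t 0 = 0, t 1 = 1, t (2k) = - t k, t (2k+1) = - t k - t (k+1)  (k ≥ 1).
tF : ℕ → ℕ → ℤ
tF zero    _ = + 0
tF (suc f) n with n % 2 | n / 2
... | 0 | 0 = + 0
... | 0 | k = - tF f k
... | _ | 0 = + 1
... | _ | k = (- tF f k) ℤ.- tF f (suc k)

t : ℕ → ℤ
t n = tF (suc n) n

bitℤ : Fin 2 → ℤ
bitℤ b = + toℕ b

-- Value of the bit string b₀ … b_m : Σ_{i=0}^m 2^i b_i
-- (bits are given as a function ℕ → Fin 2; only b₀ … b_m are used)
value : (m : ℕ) → (ℕ → Fin 2) → ℕ
value zero    b = toℕ (b 0)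
value (suc m) b = value m b + 2 ^ suc m * toℕ (b (suc m))

Vec2 : Set
Vec2 = ℤ × ℤ

record Mat2 : Set where
  constructor mat
  field a b c d : ℤ

_·_ : Mat2 → Vec2 → Vec2
mat a b c d · (x , y) = (a ℤ.* x ℤ.+ b ℤ.* y , c ℤ.* x ℤ.+ d ℤ.* y)

Mbit : Fin 2 → Mat2
Mbit β = mat (+ 1) (+ 1 ℤ.- bitℤ β) (bitℤ β) (+ 1)

-- M_{j} M_{j-1} ⋯ M_1 v, with M_i = Mbit (bit i);  j = 0 gives v.
applyMs : (j : ℕ) → (ℕ → Fin 2) → Vec2 → Vec2
applyMs zero    bit v = v
applyMs (suc j) bit v = Mbit (bit (suc j)) · applyMs j bit v

sign : ℕ → ℤ
sign zero    = + 1
sign (suc m) = - sign m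

row1m1 : Vec2 → ℤ
row1m1 (x , y) = x ℤ.- y

module Submission where

-- Write P(k) = (t k , t (k+1)) for the pair of consecutive
-- values of the twisted Stern sequence.  For k ≥ 1 and a bit β the defining
-- recurrences say exactly that
--     P(2k + β) = - M(β)ᵀ P(k),
-- where M(β) = [[1 , 1-β] , [β , 1]] is the matrix of the paper.  Pairing
-- with a row vector w and moving the transpose across the dot product gives
--     w · P(2k + β) = - (M(β) w) · P(k).
-- Reading the binary digits of k·2^(j+1) + (b_j … b_0)₂ from the least
-- significant one upwards and applying this step j+1 times yields
--     w · P(k·2^(j+1) + value j b) = (-1)^(j+1) (M_j ⋯ M_1 M_0 w) · P(k).
-- The theorem is the case k = 1 (the leading digit b_m = 1 with j = m-1),
-- w = (1 , 0) (so that the left side is t n), using M_0 (1,0) = (1 , b_0)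
-- and P(1) = (1 , -1).

open import Defs
open import Data.Nat using (ℕ; _≤_; _+_)
open import Data.Fin using (Fin)
open import Data.Integer as ℤ using (ℤ; +_)
open import Data.Product using (_,_)
open import Relation.Binary.PropositionalEquality using (_≡_)

open import Data.Nat using (zero; suc; _<_; _*_; _^_; _%_; _/_; s≤s; s≤s⁻¹)
open import Data.Nat.Properties using (≤-refl; ≤-trans; <-≤-trans; n≤1+n; m≤m*n; +-identityʳ; +-comm)
open import Data.Nat.DivMod using (m*n%n≡0; m*n/n≡m; [m+kn]%n≡m%n; +-distrib-/)
open import Data.Integer using (-_)
open import Data.Fin using (toℕ) renaming (zero to 0F; suc to sucF)
open import Data.Fin.Properties using (toℕ<n)
open import Data.Empty using (⊥-elim)
open import Function using (_∘_)
open import Relation.Nullary using (¬_)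
open import Relation.Binary.PropositionalEquality using (refl; cong; cong₂; sym; trans; subst; module ≡-Reasoning)
import Data.Nat.Tactic.RingSolver as ℕ-Solver
import Data.Integer.Tactic.RingSolver as ℤ-Solver

-- Division by 2 of 2k and 2k+1, needed to unfold the `with` in tF.
even-mod : ∀ k → (k * 2) % 2 ≡ 0
even-mod k = m*n%n≡0 k 2

even-div : ∀ k → (k * 2) / 2 ≡ k
even-div k = m*n/n≡m k 2

odd-mod : ∀ k → (1 + k * 2) % 2 ≡ 1
odd-mod k = [m+kn]%n≡m%n 1 k 2

odd-div : ∀ k → (1 + k * 2) / 2 ≡ k
odd-div k = trans
  (+-distrib-/ 1 (k * 2) (subst (λ r → 1 + r < 2) (sym (even-mod k)) ≤-refl))
  (even-div k)

tF-even : ∀ f k → tF (suc f) (suc k * 2) ≡ - tF f (suc k)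
tF-even f k rewrite even-mod (suc k) | even-div (suc k) = refl

tF-odd : ∀ f k → tF (suc f) (suc (suc k * 2)) ≡ (- tF f (suc k)) ℤ.- tF f (suc (suc k))
tF-odd f k rewrite odd-mod (suc k) | odd-div (suc k) = refl

data Shape : ℕ → Set where
  is-zero : Shape 0
  is-one  : Shape 1
  is-even : ∀ k → Shape (suc k * 2)
  is-odd  : ∀ k → Shape (suc (suc k * 2))

shape : ∀ n → Shape n
shape zero          = is-zero
shape (suc zero)    = is-one
shape (suc (suc n)) with shape n
... | is-zero  = is-even 0
... | is-one   = is-odd 0
... | is-even k = is-even (suc k)
... | is-odd k  = is-odd (suc k)

-- The recursive calls of tF are at strictly smaller arguments, so one unit
-- of fuel less still suffices for them.
fuel-drop : ∀ {m n f} → m < n → n < suc f → m < f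
fuel-drop m<n n<1+f = <-≤-trans m<n (s≤s⁻¹ n<1+f)

half<even : ∀ k → suc k < suc k * 2
half<even k = s≤s (s≤s (m≤m*n k 2))

half<odd : ∀ k → suc k < suc (suc k * 2)
half<odd k = ≤-trans (half<even k) (n≤1+n _)

half+1<odd : ∀ k → suc (suc k) < suc (suc k * 2)
half+1<odd k = s≤s (half<even k)

tF-stable : ∀ f g n → n < f → n < g → tF f n ≡ tF g n
tF-stable (suc f) (suc g) n n<f n<g with shape n
... | is-zero  = refl
... | is-one   = refl
... | is-even k rewrite tF-even f k | tF-even g k =
  cong -_ (tF-stable f g (suc k)
    (fuel-drop (half<even k) n<f) (fuel-drop (half<even k) n<g))
... | is-odd k rewrite tF-odd f k | tF-odd g k =
  cong₂ ℤ._-_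
    (cong -_ (tF-stable f g (suc k)
      (fuel-drop (half<odd k) n<f) (fuel-drop (half<odd k) n<g)))
    (tF-stable f g (suc (suc k))
      (fuel-drop (half+1<odd k) n<f) (fuel-drop (half+1<odd k) n<g))

tF-sufficient : ∀ f n → n < f → tF f n ≡ t n
tF-sufficient f n n<f = tF-stable f (suc n) n n<f ≤-refl

t-even : ∀ k → t (suc k * 2) ≡ - t (suc k)
t-even k = trans (tF-even _ k)
  (cong -_ (tF-sufficient _ (suc k) (fuel-drop (half<even k) ≤-refl)))

t-odd : ∀ k → t (suc (suc k * 2)) ≡ (- t (suc k)) ℤ.- t (suc (suc k))
t-odd k = trans (tF-odd _ k)
  (cong₂ ℤ._-_
    (cong -_ (tF-sufficient _ (suc k) (fuel-drop (half<odd k) ≤-refl)))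
    (tF-sufficient _ (suc (suc k)) (fuel-drop (half+1<odd k) ≤-refl)))

tPair : ℕ → Vec2
tPair k = (t k , t (suc k))

dot : Vec2 → Vec2 → ℤ
dot (x , y) (p , q) = x ℤ.* p ℤ.+ y ℤ.* q

neg : Vec2 → Vec2
neg (p , q) = (- p , - q)

transpose : Mat2 → Mat2
transpose (mat a b c d) = mat a c b d

dot-transpose : ∀ A w v → dot w (transpose A · v) ≡ dot (A · w) v
dot-transpose (mat a b c d) (x , y) (p , q) = ring a b c d x y p q
  where
  ring : ∀ a b c d x y p q →
    x ℤ.* (a ℤ.* p ℤ.+ c ℤ.* q) ℤ.+ y ℤ.* (b ℤ.* p ℤ.+ d ℤ.* q)
      ≡ (a ℤ.* x ℤ.+ b ℤ.* y) ℤ.* p ℤ.+ (c ℤ.* x ℤ.+ d ℤ.* y) ℤ.* q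
  ring = ℤ-Solver.solve-∀

dot-neg : ∀ w v → dot w (neg v) ≡ - dot w v
dot-neg (x , y) (p , q) = ring x y p q
  where
  ring : ∀ x y p q → x ℤ.* (- p) ℤ.+ y ℤ.* (- q) ≡ - (x ℤ.* p ℤ.+ y ℤ.* q)
  ring = ℤ-Solver.solve-∀

tPair-double : ∀ k β → tPair (suc k * 2 + toℕ β) ≡ neg (transpose (Mbit β) · tPair (suc k))
tPair-double k 0F = begin
  tPair (suc k * 2 + 0)                  ≡⟨ cong tPair (+-identityʳ (suc k * 2)) ⟩
  (t (suc k * 2) , t (suc (suc k * 2)))  ≡⟨ cong₂ _,_ (t-even k) (t-odd k) ⟩
  (- p , (- p) ℤ.- q)                    ≡⟨ cong₂ _,_ (first p q) (second p q) ⟩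
  neg (transpose (Mbit 0F) · (p , q))    ∎
  where
  open ≡-Reasoning
  p q : ℤ
  p = t (suc k)
  q = t (suc (suc k))
  first : ∀ p q → - p ≡ - (+ 1 ℤ.* p ℤ.+ + 0 ℤ.* q)
  first = ℤ-Solver.solve-∀
  second : ∀ p q → (- p) ℤ.- q ≡ - ((+ 1 ℤ.- + 0) ℤ.* p ℤ.+ + 1 ℤ.* q)
  second = ℤ-Solver.solve-∀
tPair-double k (sucF 0F) = begin
  tPair (suc k * 2 + 1)                        ≡⟨ cong tPair (+-comm (suc k * 2) 1) ⟩
  (t (suc (suc k * 2)) , t (suc (suc k) * 2))  ≡⟨ cong₂ _,_ (t-odd k) (t-even (suc k)) ⟩
  ((- p) ℤ.- q , - q)                          ≡⟨ cong₂ _,_ (first p q) (second p q) ⟩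
  neg (transpose (Mbit (sucF 0F)) · (p , q))   ∎
  where
  open ≡-Reasoning
  p q : ℤ
  p = t (suc k)
  q = t (suc (suc k))
  first : ∀ p q → (- p) ℤ.- q ≡ - (+ 1 ℤ.* p ℤ.+ + 1 ℤ.* q)
  first = ℤ-Solver.solve-∀
  second : ∀ p q → - q ≡ - ((+ 1 ℤ.- + 1) ℤ.* p ℤ.+ + 1 ℤ.* q)
  second = ℤ-Solver.solve-∀

dot-double : ∀ w k β → dot w (tPair (suc k * 2 + toℕ β)) ≡ - dot (Mbit β · w) (tPair (suc k))
dot-double w k β = begin
  dot w (tPair (suc k * 2 + toℕ β))                        ≡⟨ cong (dot w) (tPair-double k β) ⟩
  dot w (neg (transpose (Mbit β) · tPair (suc k)))         ≡⟨ dot-neg w _ ⟩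
  - dot w (transpose (Mbit β) · tPair (suc k))             ≡⟨ cong -_ (dot-transpose (Mbit β) w _) ⟩
  - dot (Mbit β · w) (tPair (suc k))                       ∎
  where open ≡-Reasoning

-- Appending the binary digit β above a block of j+1 digits amounts to
-- doubling the prefix k and adding β.
append-digit : ∀ k P V β → suc k * (2 * P) + (V + P * β) ≡ (suc k * 2 + β) * P + V
append-digit = ℕ-Solver.solve-∀

sign-absorb : ∀ s x → s ℤ.* (- x) ≡ (- s) ℤ.* x
sign-absorb = ℤ-Solver.solve-∀

dot-digits : ∀ j b w k →
  dot w (tPair (suc k * 2 ^ suc j + value j b))
    ≡ sign (suc j) ℤ.* dot (applyMs j b (Mbit (b 0) · w)) (tPair (suc k))
dot-digits zero b w k = begin
  dot w (tPair (suc k * 2 ^ 1 + toℕ (b 0)))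
    ≡⟨ cong (λ e → dot w (tPair (e + toℕ (b 0)))) (one-digit k) ⟩
  dot w (tPair (suc k * 2 + toℕ (b 0)))
    ≡⟨ dot-double w k (b 0) ⟩
  - dot (Mbit (b 0) · w) (tPair (suc k))
    ≡⟨ minus-is-sign₁ _ ⟩
  sign 1 ℤ.* dot (Mbit (b 0) · w) (tPair (suc k)) ∎
  where
  open ≡-Reasoning
  one-digit : ∀ k → suc k * 2 ^ 1 ≡ suc k * 2
  one-digit = ℕ-Solver.solve-∀
  minus-is-sign₁ : ∀ x → - x ≡ sign 1 ℤ.* x
  minus-is-sign₁ = ℤ-Solver.solve-∀
dot-digits (suc j) b w k = begin
  dot w (tPair (suc k * 2 ^ suc (suc j) + value (suc j) b))
    ≡⟨ cong (dot w ∘ tPair) (append-digit k (2 ^ suc j) (value j b) (toℕ β)) ⟩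
  dot w (tPair ((suc k * 2 + toℕ β) * 2 ^ suc j + value j b))
    ≡⟨ dot-digits j b w (suc (k * 2 + toℕ β)) ⟩
  sign (suc j) ℤ.* dot v (tPair (suc k * 2 + toℕ β))
    ≡⟨ cong (sign (suc j) ℤ.*_) (dot-double v k β) ⟩
  sign (suc j) ℤ.* (- dot (Mbit β · v) (tPair (suc k)))
    ≡⟨ sign-absorb (sign (suc j)) _ ⟩
  sign (suc (suc j)) ℤ.* dot (applyMs (suc j) b (Mbit (b 0) · w)) (tPair (suc k)) ∎
  where
  open ≡-Reasoning
  β : Fin 2
  β = b (suc j)
  v : Vec2
  v = applyMs j b (Mbit (b 0) · w)

e₁ : Vec2
e₁ = (+ 1 , + 0)

t-via-tPair : ∀ n → t n ≡ dot e₁ (tPair n)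
t-via-tPair n = ring (t n) (t (suc n))
  where
  ring : ∀ p q → p ≡ + 1 ℤ.* p ℤ.+ + 0 ℤ.* q
  ring = ℤ-Solver.solve-∀

Mbit-e₁ : ∀ β → Mbit β · e₁ ≡ (+ 1 , bitℤ β)
Mbit-e₁ β = cong₂ _,_ (first (bitℤ β)) (second (bitℤ β))
  where
  first : ∀ b → + 1 ℤ.* + 1 ℤ.+ (+ 1 ℤ.- b) ℤ.* + 0 ≡ + 1
  first = ℤ-Solver.solve-∀
  second : ∀ b → b ℤ.* + 1 ℤ.+ + 1 ℤ.* + 0 ≡ b
  second = ℤ-Solver.solve-∀

dot-tPair₁ : ∀ w → dot w (tPair 1) ≡ row1m1 w
dot-tPair₁ (x , y) = ring x y
  where
  ring : ∀ x y → x ℤ.* + 1 ℤ.+ y ℤ.* - (+ 1) ≡ x ℤ.- y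
  ring = ℤ-Solver.solve-∀

-- With leading digit b_{j+1} = 1, n = 1·2^(j+1) + (b_j … b_0)₂.
leading-one : ∀ P V → V + P * 1 ≡ 1 * P + V
leading-one = ℕ-Solver.solve-∀

-- A single binary digit is below 4, so n ≥ 4 forces m ≥ 1.
single-digit-small : ∀ b → ¬ (4 ≤ value zero b)
single-digit-small b 4≤b₀ with ≤-trans 4≤b₀ (≤-trans (n≤1+n _) (toℕ<n (b 0)))
... | s≤s (s≤s ())

theorem4p2 : (n : ℕ) → 4 ≤ n → (m : ℕ) → (b : ℕ → Fin 2) →
    value m b ≡ n → b m ≡ Data.Fin.suc Data.Fin.zero →
    t n ≡ sign m ℤ.* row1m1 (applyMs (m Data.Nat.∸ 1) b (+ 1 , bitℤ (b 0)))
theorem4p2 _ 4≤n zero b refl _ = ⊥-elim (single-digit-small b 4≤n)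
theorem4p2 _ _ (suc j) b refl bₘ≡1 = begin
  t (value j b + 2 ^ suc j * toℕ (b (suc j)))
    ≡⟨ cong (λ d → t (value j b + 2 ^ suc j * toℕ d)) bₘ≡1 ⟩
  t (value j b + 2 ^ suc j * 1)
    ≡⟨ cong t (leading-one (2 ^ suc j) (value j b)) ⟩
  t (1 * 2 ^ suc j + value j b)
    ≡⟨ t-via-tPair (1 * 2 ^ suc j + value j b) ⟩
  dot e₁ (tPair (1 * 2 ^ suc j + value j b))
    ≡⟨ dot-digits j b e₁ 0 ⟩
  sign (suc j) ℤ.* dot (applyMs j b (Mbit (b 0) · e₁)) (tPair 1)
    ≡⟨ cong (λ v → sign (suc j) ℤ.* dot (applyMs j b v) (tPair 1)) (Mbit-e₁ (b 0)) ⟩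
  sign (suc j) ℤ.* dot (applyMs j b (+ 1 , bitℤ (b 0))) (tPair 1)
    ≡⟨ cong (sign (suc j) ℤ.*_) (dot-tPair₁ (applyMs j b (+ 1 , bitℤ (b 0)))) ⟩
  sign (suc j) ℤ.* row1m1 (applyMs j b (+ 1 , bitℤ (b 0)))  ∎
  where open ≡-Reasoning
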